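{- Let $\boldsymbol\xi_1, \dots, \boldsymbol\xi_L$ be linearly independent points in $E_N \cup F_N$, and assume that exactly $K$ of them belong to $E_N$, where $1 \le K < L$. Then there exist linearly independent points $\boldsymbol\eta_1, \dots, \boldsymbol\eta_{L-K}$ in $E_{N-K} \cup F_{N-K}$ such that $$\|\boldsymbol\xi_1 \wedge \boldsymbol\xi_2 \wedge \cdots \wedge \boldsymbol\xi_L\|_1 = \|\boldsymbol\eta_1 \wedge \boldsymbol\eta_2 \wedge \cdots \wedge \boldsymbol\eta_{L-K}\|_1.$$
   Context: For $M\ge1$, $E_M = \{\pm\boldsymbol e_m : 1\le m\le M\}$ and $F_M = \{\boldsymbol e_m - \boldsymbol e_n : 1\le m,n\le M,\ m\ne n\}$, with $\boldsymbol e_m$ the standard basis vectors of $\mathbb{R}^M$. For $\boldsymbol x_1,\dots,\boldsymbol x_L\in\mathbb{R}^M$ with $M\times L$ matrix $X$, $\|\boldsymbol x_1\wedge\cdots\wedge\boldsymbol x_L\|_1 = \sum_{I\subseteq\{1,\dots,M\},|I|=L}|\det X_I|$, with $X_I$ the submatrix of rows indexed by $I$. -}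

module Defs where

open import Data.Nat using (ℕ; zero; suc)
open import Data.Fin using (Fin; zero; suc; punchIn)
open import Data.Integer using (ℤ; +_; -_; _+_; _*_; ∣_∣)
open import Data.List using (List; []; _∷_; _++_; map)
open import Data.Vec using (Vec; []; _∷_; lookup)
import Data.Vec as Vec
open import Data.Product using (Σ; ∃; _×_; _,_)
open import Data.Sum using (_⊎_)
open import Relation.Binary.PropositionalEquality using (_≡_; _≢_)

-- Vectors in ℤ^M (all points of E_M ∪ F_M have integer coordinates)
Pt : ℕ → Set
Pt M = Fin M → ℤ

e : ∀ {M} → Fin M → Pt M
e zero    zero    = + 1
e zero    (suc _) = + 0
e (suc m) zero    = + 0
e (suc m) (suc i) = e m i

InE : ∀ M → Pt M → Set
InE M x = Σ (Fin M) λ m → (∀ i → x i ≡ e m i) ⊎ (∀ i → x i ≡ - e m i)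

InF : ∀ M → Pt M → Set
InF M x = Σ (Fin M) λ m → Σ (Fin M) λ n → m ≢ n × (∀ i → x i ≡ e m i + - e n i)

sumℤ : ∀ n → (Fin n → ℤ) → ℤ
sumℤ zero    f = + 0
sumℤ (suc n) f = f zero + sumℤ n (λ i → f (suc i))

sumℕ : List ℕ → ℕ
sumℕ []       = 0
sumℕ (x ∷ xs) = x Data.Nat.+ sumℕ xs

-- linear independence of x_1..x_L (integer vectors; equivalent to real
-- linear independence after clearing denominators)
LinIndep : ∀ M L → (Fin L → Pt M) → Set
LinIndep M L x = (c : Fin L → ℤ) → (∀ r → sumℤ L (λ j → c j * x j r) ≡ + 0) → ∀ j → c j ≡ + 0

sgn : ∀ {n} → Fin n → ℤ
sgn zero          = + 1
sgn (suc zero)    = - (+ 1)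
sgn (suc (suc j)) = sgn j

det : ∀ n → (Fin n → Fin n → ℤ) → ℤ
det zero    A = + 1
det (suc n) A = sumℤ (suc n) (λ j → sgn j * (A zero j * det n (λ a b → A (suc a) (punchIn j b))))

-- all strictly increasing L-tuples of elements of Fin M (i.e. all L-subsets I)
choose : ∀ L M → List (Vec (Fin M) L)
choose zero    M       = [] ∷ []
choose (suc L) zero    = []
choose (suc L) (suc M) = map (λ v → zero ∷ Vec.map suc v) (choose L M)
                      ++ map (Vec.map suc) (choose (suc L) M)

-- ‖x_1 ∧ … ∧ x_L‖_1 = Σ_{|I| = L} |det X_I|, X the M×L matrix with columns x_j
wedgeNorm : ∀ M L → (Fin L → Pt M) → ℕ
wedgeNorm M L x = sumℕ (map (λ I → ∣ det L (λ a b → x b (lookup I a)) ∣) (choose L M))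

{-# OPTIONS --safe #-}
-- Let ξ_p = ±e_m be one of the points in E_N. Expanding a maximal minor X_I along
-- column p shows that it vanishes unless m ∈ I, and that otherwise it equals, up to
-- sign, the minor of the matrix with row m and column p deleted. So deleting the
-- point ξ_p and the m-th coordinate of the others preserves the wedge norm. The
-- shortened points stay linearly independent, hence nonzero, and deleting a
-- coordinate maps nonzero points of E ∪ F into E ∪ F (e_k − e_m becomes e_k) and
-- points of E into E. Doing this once for each of the K points in E_N gives the η.
module Submission where

open import Defs
open import Data.Nat as ℕ using (ℕ; zero; suc; _≤_; _<_; _∸_)
import Data.Nat.Properties as ℕ
open import Data.Fin using (Fin; zero; suc; punchIn; punchOut; toℕ; _≟_)
open import Data.Fin.Properties using (punchInᵢ≢i; punchIn-punchOut; suc-injective; 0≢1+n)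
open import Data.Fin.Subset using (Subset; _∈_; ∣_∣; inside; outside)
open import Data.Integer as ℤ using (ℤ; 0ℤ; 1ℤ; -1ℤ; _+_; _*_; -_; _^_)
open import Data.Integer.Properties
  using (+-*-semiring; +-identityˡ; +-identityʳ; *-identityˡ; *-identityʳ; *-zeroʳ;
         abs-*; -1*i≡-i; ^-distribˡ-+-*)
open import Data.Integer.Tactic.RingSolver using (solve-∀)
open import Algebra.Properties.Semiring.Sum +-*-semiring
  using (sum; sum-cong-≗; sum-remove; sum-replicate-zero; *-distribˡ-sum)
open import Data.List using ([]; _∷_; _++_; map)
open import Data.List.Properties using (map-++; map-∘; map-cong)
open import Data.Vec as Vec using (Vec; []; _∷_; lookup; removeAt; here; there)
open import Data.Vec.Properties using (lookup-map)
open import Data.Vec.Functional using (insertAt)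
open import Data.Vec.Functional.Properties using (insertAt-lookup; insertAt-punchIn)
open import Data.Product using (Σ; Σ-syntax; _×_; _,_; proj₁; proj₂)
open import Data.Sum as Sum using (_⊎_; inj₁; inj₂; [_,_]′)
open import Data.Empty using (⊥-elim)
open import Function.Base using (_∘_)
open import Function.Bundles using (_⇔_; Equivalence)
open import Relation.Nullary using (¬_; yes; no; contradiction)
open import Relation.Binary.PropositionalEquality
open ≡-Reasoning

sumℤ≡sum : ∀ n (f : Fin n → ℤ) → sumℤ n f ≡ sum f
sumℤ≡sum zero    f = refl
sumℤ≡sum (suc n) f = cong (f zero +_) (sumℤ≡sum n (f ∘ suc))

sumℤ-remove : ∀ {n} (f : Fin (suc n) → ℤ) q → sumℤ (suc n) f ≡ f q + sum (f ∘ punchIn q)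
sumℤ-remove {n} f q = trans (sumℤ≡sum (suc n) f) (sum-remove f)

sum-zero : ∀ {n} {f : Fin n → ℤ} → (∀ j → f j ≡ 0ℤ) → sum f ≡ 0ℤ
sum-zero {n} f≗0 = trans (sum-cong-≗ f≗0) (sum-replicate-zero n)

sumℕ-++ : ∀ xs ys → sumℕ (xs ++ ys) ≡ sumℕ xs ℕ.+ sumℕ ys
sumℕ-++ []       ys = refl
sumℕ-++ (x ∷ xs) ys = trans (cong (x ℕ.+_) (sumℕ-++ xs ys)) (sym (ℕ.+-assoc x _ _))

sumℕ-map-zero : ∀ {A : Set} {F : A → ℕ} xs → (∀ x → F x ≡ 0) → sumℕ (map F xs) ≡ 0
sumℕ-map-zero []       F≗0 = refl
sumℕ-map-zero (x ∷ xs) F≗0 = cong₂ ℕ._+_ (F≗0 x) (sumℕ-map-zero xs F≗0)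

∣u*i∣≡∣i∣ : ∀ u i → ℤ.∣ u ∣ ≡ 1 → ℤ.∣ u * i ∣ ≡ ℤ.∣ i ∣
∣u*i∣≡∣i∣ u i ∣u∣≡1 = trans (abs-* u i) (trans (cong (ℕ._* ℤ.∣ i ∣) ∣u∣≡1) (ℕ.*-identityˡ _))

∣-1^n∣≡1 : ∀ n → ℤ.∣ -1ℤ ^ n ∣ ≡ 1
∣-1^n∣≡1 zero    = refl
∣-1^n∣≡1 (suc n) = trans (∣u*i∣≡∣i∣ -1ℤ (-1ℤ ^ n) refl) (∣-1^n∣≡1 n)

i*i≡1⇒∣i∣≡1 : ∀ i → i * i ≡ 1ℤ → ℤ.∣ i ∣ ≡ 1
i*i≡1⇒∣i∣≡1 i i*i≡1 = ℕ.m*n≡1⇒m≡1 ℤ.∣ i ∣ ℤ.∣ i ∣ (trans (sym (abs-* i i)) (cong ℤ.∣_∣ i*i≡1))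

sgn≡-1^toℕ : ∀ {n} (j : Fin n) → sgn j ≡ -1ℤ ^ toℕ j
sgn≡-1^toℕ zero          = refl
sgn≡-1^toℕ (suc zero)    = refl
sgn≡-1^toℕ (suc (suc j)) = trans (sgn≡-1^toℕ j) (-1*-1*i≡i (-1ℤ ^ toℕ j))
  where
  -1*-1*i≡i : ∀ i → i ≡ -1ℤ * (-1ℤ * i)
  -1*-1*i≡i = solve-∀

-- q′ is the index of column q once column punchIn q j has been deleted.
punchIn-exchange : ∀ {n} (q : Fin (suc (suc n))) (j : Fin (suc n)) → Σ[ q′ ∈ Fin (suc n) ]
    punchIn (punchIn q j) q′ ≡ q
  × (∀ y → punchIn (punchIn q j) (punchIn q′ y) ≡ punchIn q (punchIn j y))
  × -1ℤ ^ toℕ (punchIn q j) * -1ℤ ^ toℕ q′ ≡ - (-1ℤ ^ toℕ q * -1ℤ ^ toℕ j)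
punchIn-exchange zero    j    = zero , refl , (λ _ → refl) , sign (-1ℤ ^ toℕ j)
  where
  sign : ∀ s → (-1ℤ * s) * 1ℤ ≡ - (1ℤ * s)
  sign = solve-∀
punchIn-exchange (suc q) zero = q , refl , (λ _ → refl) , sign (-1ℤ ^ toℕ q)
  where
  sign : ∀ s → 1ℤ * s ≡ - ((-1ℤ * s) * 1ℤ)
  sign = solve-∀
punchIn-exchange {suc _} (suc q) (suc j) with punchIn-exchange q j
... | q′ , q′↦q , exchange , parity =
  suc q′ , cong suc q′↦q , exchange′ , trans (flip₁ (-1ℤ ^ toℕ (punchIn q j)) (-1ℤ ^ toℕ q′))
    (trans parity (flip₂ (-1ℤ ^ toℕ q) (-1ℤ ^ toℕ j)))
  where
  exchange′ : ∀ y → punchIn (suc (punchIn q j)) (punchIn (suc q′) y) ≡ punchIn (suc q) (punchIn (suc j) y)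
  exchange′ zero    = refl
  exchange′ (suc y) = cong suc (exchange y)
  flip₁ : ∀ a b → (-1ℤ * a) * (-1ℤ * b) ≡ a * b
  flip₁ = solve-∀
  flip₂ : ∀ c d → - (c * d) ≡ - ((-1ℤ * c) * (-1ℤ * d))
  flip₂ = solve-∀

Matrix : ℕ → Set
Matrix n = Fin n → Fin n → ℤ

minor : ∀ {n} → Fin (suc n) → Fin (suc n) → Matrix (suc n) → Matrix n
minor a q A x y = A (punchIn a x) (punchIn q y)

laplaceTerm : ∀ {n} → Matrix (suc n) → Fin (suc n) → ℤ
laplaceTerm {n} A j = sgn j * (A zero j * det n (minor zero j A))

det-expand : ∀ {n} (A : Matrix (suc n)) → det (suc n) A ≡ sum (laplaceTerm A)
det-expand {n} A = sumℤ≡sum (suc n) (laplaceTerm A)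

det-cong : ∀ n {A B : Matrix n} → (∀ x y → A x y ≡ B x y) → det n A ≡ det n B
det-cong zero    A≗B = refl
det-cong (suc n) {A} {B} A≗B = begin
  det (suc n) A        ≡⟨ det-expand A ⟩
  sum (laplaceTerm A)  ≡⟨ sum-cong-≗ term≗ ⟩
  sum (laplaceTerm B)  ≡⟨ det-expand B ⟨
  det (suc n) B        ∎
  where
  term≗ : ∀ j → laplaceTerm A j ≡ laplaceTerm B j
  term≗ j = cong₂ (λ a d → sgn j * (a * d)) (A≗B zero j) (det-cong n (λ x y → A≗B (suc x) (punchIn j y)))

det-zeroColumn : ∀ n (A : Matrix n) q → (∀ x → A x q ≡ 0ℤ) → det n A ≡ 0ℤ
laplaceTerm-zeroColumn : ∀ n (A : Matrix (suc n)) q j → (∀ x → A (suc x) q ≡ 0ℤ) →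
  laplaceTerm A (punchIn q j) ≡ 0ℤ

det-zeroColumn (suc n) A q column≡0 = begin
  det (suc n) A                                      ≡⟨ det-expand A ⟩
  sum (laplaceTerm A)                                ≡⟨ sum-remove {i = q} (laplaceTerm A) ⟩
  laplaceTerm A q + sum (laplaceTerm A ∘ punchIn q)  ≡⟨ cong₂ _+_ pivot-term (sum-zero other-term) ⟩
  0ℤ                                                 ∎
  where
  pivot-term : laplaceTerm A q ≡ 0ℤ
  pivot-term = trans (cong (λ a → sgn q * (a * det n (minor zero q A))) (column≡0 zero)) (*-zeroʳ (sgn q))
  other-term : ∀ j → laplaceTerm A (punchIn q j) ≡ 0ℤ
  other-term j = laplaceTerm-zeroColumn n A q j (column≡0 ∘ suc)

laplaceTerm-zeroColumn (suc n) A q j column≡0 = begin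
  sgn (punchIn q j) * (A zero (punchIn q j) * det (suc n) (minor zero (punchIn q j) A))
    ≡⟨ cong (λ d → sgn (punchIn q j) * (A zero (punchIn q j) * d))
         (det-zeroColumn (suc n) (minor zero (punchIn q j) A) q′ column′≡0) ⟩
  sgn (punchIn q j) * (A zero (punchIn q j) * 0ℤ)
    ≡⟨ cong (sgn (punchIn q j) *_) (*-zeroʳ (A zero (punchIn q j))) ⟩
  sgn (punchIn q j) * 0ℤ
    ≡⟨ *-zeroʳ (sgn (punchIn q j)) ⟩
  0ℤ ∎
  where
  q′ = proj₁ (punchIn-exchange q j)
  column′≡0 : ∀ x → minor zero (punchIn q j) A x q′ ≡ 0ℤ
  column′≡0 x = trans (cong (A (suc x)) (proj₁ (proj₂ (punchIn-exchange q j)))) (column≡0 x)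

sign-shuffle : ∀ sⱼ sq′ sₐ sq sⱼ′ X c D → sⱼ * sq′ ≡ - (sq * sⱼ′) →
  sⱼ * (X * ((sₐ * sq′) * (c * D))) ≡ -1ℤ * (sₐ * sq) * (c * (sⱼ′ * (X * D)))
sign-shuffle sⱼ sq′ sₐ sq sⱼ′ X c D parity = begin
  sⱼ * (X * ((sₐ * sq′) * (c * D)))     ≡⟨ regroup sⱼ sq′ sₐ X c D ⟩
  (sⱼ * sq′) * (sₐ * X * c * D)         ≡⟨ cong (_* (sₐ * X * c * D)) parity ⟩
  - (sq * sⱼ′) * (sₐ * X * c * D)       ≡⟨ ungroup sq sⱼ′ sₐ X c D ⟩
  -1ℤ * (sₐ * sq) * (c * (sⱼ′ * (X * D))) ∎
  where
  regroup : ∀ sⱼ sq′ sₐ X c D → sⱼ * (X * ((sₐ * sq′) * (c * D))) ≡ (sⱼ * sq′) * (sₐ * X * c * D)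
  regroup = solve-∀
  ungroup : ∀ sq sⱼ′ sₐ X c D → - (sq * sⱼ′) * (sₐ * X * c * D) ≡ -1ℤ * (sₐ * sq) * (c * (sⱼ′ * (X * D)))
  ungroup = solve-∀

det-expandColumn : ∀ n (A : Matrix (suc n)) a q → (∀ x → A (punchIn a x) q ≡ 0ℤ) →
  det (suc n) A ≡ -1ℤ ^ (toℕ a ℕ.+ toℕ q) * (A a q * det n (minor a q A))
laplaceTerm-expandColumn : ∀ n (A : Matrix (suc (suc n))) a q j → (∀ x → A (punchIn (suc a) x) q ≡ 0ℤ) →
  laplaceTerm A (punchIn q j)
    ≡ -1ℤ ^ (toℕ (suc a) ℕ.+ toℕ q) * (A (suc a) q * laplaceTerm (minor (suc a) q A) j)

det-expandColumn n A zero q column≡0 = begin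
  det (suc n) A                                      ≡⟨ det-expand A ⟩
  sum (laplaceTerm A)                                ≡⟨ sum-remove {i = q} (laplaceTerm A) ⟩
  laplaceTerm A q + sum (laplaceTerm A ∘ punchIn q)  ≡⟨ cong (laplaceTerm A q +_) (sum-zero other-term) ⟩
  laplaceTerm A q + 0ℤ                               ≡⟨ +-identityʳ _ ⟩
  laplaceTerm A q
    ≡⟨ cong (_* (A zero q * det n (minor zero q A))) (sgn≡-1^toℕ q) ⟩
  -1ℤ ^ toℕ q * (A zero q * det n (minor zero q A))  ∎
  where
  other-term : ∀ j → laplaceTerm A (punchIn q j) ≡ 0ℤ
  other-term j = laplaceTerm-zeroColumn n A q j column≡0
det-expandColumn (suc n) A (suc a) q column≡0 = begin
  det (suc (suc n)) A                                ≡⟨ det-expand A ⟩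
  sum (laplaceTerm A)                                ≡⟨ sum-remove {i = q} (laplaceTerm A) ⟩
  laplaceTerm A q + sum (laplaceTerm A ∘ punchIn q)  ≡⟨ cong₂ _+_ pivot-term (sum-cong-≗ other-term) ⟩
  0ℤ + sum (λ j → s * (c * laplaceTerm A′ j))        ≡⟨ +-identityˡ _ ⟩
  sum (λ j → s * (c * laplaceTerm A′ j))             ≡⟨ *-distribˡ-sum s (λ j → c * laplaceTerm A′ j) ⟨
  s * sum (λ j → c * laplaceTerm A′ j)               ≡⟨ cong (s *_) (*-distribˡ-sum c (laplaceTerm A′)) ⟨
  s * (c * sum (laplaceTerm A′))                     ≡⟨ cong (λ d → s * (c * d)) (det-expand A′) ⟨
  s * (c * det (suc n) A′)                           ∎
  where
  s = -1ℤ ^ (toℕ (suc a) ℕ.+ toℕ q)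
  c = A (suc a) q
  A′ = minor (suc a) q A
  pivot-term : laplaceTerm A q ≡ 0ℤ
  pivot-term = trans (cong (λ x → sgn q * (x * det (suc n) (minor zero q A))) (column≡0 zero)) (*-zeroʳ (sgn q))
  other-term : ∀ j → laplaceTerm A (punchIn q j) ≡ s * (c * laplaceTerm A′ j)
  other-term j = laplaceTerm-expandColumn n A a q j column≡0

laplaceTerm-expandColumn n A a q j column≡0 with punchIn-exchange q j
... | q′ , q′↦q , exchange , parity = begin
    sgn j↑ * (X * det (suc n) B)
  ≡⟨ cong₂ (λ t d → t * (X * d)) (sgn≡-1^toℕ j↑) B-expand ⟩
    -1ℤ ^ toℕ j↑ * (X * ((-1ℤ ^ toℕ a * -1ℤ ^ toℕ q′) * (c * D)))
  ≡⟨ sign-shuffle (-1ℤ ^ toℕ j↑) (-1ℤ ^ toℕ q′) (-1ℤ ^ toℕ a) (-1ℤ ^ toℕ q) (-1ℤ ^ toℕ j) X c D parity ⟩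
    -1ℤ * (-1ℤ ^ toℕ a * -1ℤ ^ toℕ q) * (c * (-1ℤ ^ toℕ j * (X * D)))
  ≡⟨ cong₂ (λ t u → -1ℤ * t * (c * (u * (X * D)))) (^-distribˡ-+-* -1ℤ (toℕ a) (toℕ q)) (sgn≡-1^toℕ j) ⟨
    -1ℤ ^ (toℕ (suc a) ℕ.+ toℕ q) * (c * laplaceTerm (minor (suc a) q A) j)
  ∎
  where
  j↑ = punchIn q j
  X = A zero j↑
  B = minor zero j↑ A
  c = A (suc a) q
  D = det n (minor zero j (minor (suc a) q A))
  B-expand : det (suc n) B ≡ (-1ℤ ^ toℕ a * -1ℤ ^ toℕ q′) * (c * D)
  B-expand = begin
    det (suc n) B
      ≡⟨ det-expandColumn n B a q′ (λ x → trans (cong (A (suc (punchIn a x))) q′↦q) (column≡0 (suc x))) ⟩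
    -1ℤ ^ (toℕ a ℕ.+ toℕ q′) * (B a q′ * det n (minor a q′ B))
      ≡⟨ cong₂ (λ t u → t * (u * det n (minor a q′ B)))
               (^-distribˡ-+-* -1ℤ (toℕ a) (toℕ q′)) (cong (A (suc a)) q′↦q) ⟩
    (-1ℤ ^ toℕ a * -1ℤ ^ toℕ q′) * (c * det n (minor a q′ B))
      ≡⟨ cong (λ d → (-1ℤ ^ toℕ a * -1ℤ ^ toℕ q′) * (c * d))
              (det-cong n (λ x y → cong (A (suc (punchIn a x))) (exchange y))) ⟩
    (-1ℤ ^ toℕ a * -1ℤ ^ toℕ q′) * (c * D)
      ∎

data PunchInView {n} (m : Fin (suc n)) : Fin (suc n) → Set where
  at-hole : PunchInView m m
  punched : ∀ k → PunchInView m (punchIn m k)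

punchIn-view : ∀ {n} (m k : Fin (suc n)) → PunchInView m k
punchIn-view m k with m ≟ k
... | yes refl = at-hole
... | no m≢k   = subst (PunchInView m) (punchIn-punchOut m≢k) (punched (punchOut m≢k))

e-diag : ∀ {n} (m : Fin n) → e m m ≡ 1ℤ
e-diag zero    = refl
e-diag (suc m) = e-diag m

e-off : ∀ {n} {m r : Fin n} → m ≢ r → e m r ≡ 0ℤ
e-off {m = zero}  {zero}  m≢r = ⊥-elim (m≢r refl)
e-off {m = zero}  {suc r} m≢r = refl
e-off {m = suc m} {zero}  m≢r = refl
e-off {m = suc m} {suc r} m≢r = e-off (m≢r ∘ cong suc)

e-hole : ∀ {n} (m : Fin (suc n)) r → e m (punchIn m r) ≡ 0ℤ
e-hole m r = e-off (punchInᵢ≢i m r ∘ sym)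

e-punchIn : ∀ {n} (m : Fin (suc n)) k r → e (punchIn m k) (punchIn m r) ≡ e k r
e-punchIn zero    k       r       = refl
e-punchIn (suc m) zero    zero    = refl
e-punchIn (suc m) zero    (suc r) = refl
e-punchIn (suc m) (suc k) zero    = refl
e-punchIn (suc m) (suc k) (suc r) = e-punchIn m k r

InE⇒unit*e : ∀ {n} {x : Pt n} → InE n x → Σ[ m ∈ Fin n ] Σ[ ε ∈ ℤ ] ε * ε ≡ 1ℤ × (∀ r → x r ≡ ε * e m r)
InE⇒unit*e (m , inj₁ x≡eₘ)  = m , 1ℤ , refl , λ r → trans (x≡eₘ r) (sym (*-identityˡ (e m r)))
InE⇒unit*e (m , inj₂ x≡-eₘ) = m , -1ℤ , refl , λ r → trans (x≡-eₘ r) (sym (-1*i≡-i (e m r)))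

InE-∘-punchIn : ∀ {n} (m : Fin (suc n)) {x : Pt (suc n)} →
  InE (suc n) x → ¬ (∀ r → x (punchIn m r) ≡ 0ℤ) → InE n (x ∘ punchIn m)
InE-∘-punchIn m (k , x≡±eₖ) x∘punchIn≢0 with punchIn-view m k
... | at-hole   = ⊥-elim (x∘punchIn≢0 ([ (λ x≡eₘ r → trans (x≡eₘ _) (e-hole m r))
                                       , (λ x≡-eₘ r → trans (x≡-eₘ _) (cong -_ (e-hole m r))) ]′ x≡±eₖ))
... | punched k = k , Sum.map (λ x≡eₖ r → trans (x≡eₖ _) (e-punchIn m k r))
                              (λ x≡-eₖ r → trans (x≡-eₖ _) (cong -_ (e-punchIn m k r))) x≡±eₖ

InF-∘-punchIn : ∀ {n} (m : Fin (suc n)) {x : Pt (suc n)} →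
  InF (suc n) x → InE n (x ∘ punchIn m) ⊎ InF n (x ∘ punchIn m)
InF-∘-punchIn m {x} (k , l , k≢l , x≡eₖ-eₗ) with punchIn-view m k | punchIn-view m l
... | at-hole   | at-hole   = ⊥-elim (k≢l refl)
... | at-hole   | punched l = inj₁ (l , inj₂ λ r → begin
  x (punchIn m r)                                      ≡⟨ x≡eₖ-eₗ _ ⟩
  e m (punchIn m r) + - e (punchIn m l) (punchIn m r)  ≡⟨ cong₂ (λ a b → a + - b) (e-hole m r) (e-punchIn m l r) ⟩
  0ℤ + - e l r                                         ≡⟨ +-identityˡ _ ⟩
  - e l r                                              ∎)
... | punched k | at-hole   = inj₁ (k , inj₁ λ r → begin
  x (punchIn m r)                                      ≡⟨ x≡eₖ-eₗ _ ⟩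
  e (punchIn m k) (punchIn m r) + - e m (punchIn m r)  ≡⟨ cong₂ (λ a b → a + - b) (e-punchIn m k r) (e-hole m r) ⟩
  e k r + 0ℤ                                           ≡⟨ +-identityʳ _ ⟩
  e k r                                                ∎)
... | punched k | punched l = inj₂ (k , l , k≢l ∘ cong (punchIn m) ,
  λ r → trans (x≡eₖ-eₗ _) (cong₂ (λ a b → a + - b) (e-punchIn m k r) (e-punchIn m l r)))

LinIndep⇒nonzero : ∀ {M L} {x : Fin L → Pt M} → LinIndep M L x → ∀ j → ¬ (∀ r → x j r ≡ 0ℤ)
LinIndep⇒nonzero {L = suc L} {x} x-indep j xⱼ≡0 =
  contradiction (trans (sym (insertAt-lookup (λ _ → 0ℤ) j 1ℤ)) (x-indep δ Σδx≡0 j)) λ ()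
  where
  δ : Fin (suc L) → ℤ
  δ = insertAt (λ _ → 0ℤ) j 1ℤ
  δ∘punchIn≡0 : ∀ r i → δ (punchIn j i) * x (punchIn j i) r ≡ 0ℤ
  δ∘punchIn≡0 r i = cong (_* x (punchIn j i) r) (insertAt-punchIn (λ _ → 0ℤ) j 1ℤ i)
  Σδx≡0 : ∀ r → sumℤ (suc L) (λ i → δ i * x i r) ≡ 0ℤ
  Σδx≡0 r = begin
    sumℤ (suc L) (λ i → δ i * x i r)                    ≡⟨ sumℤ-remove (λ i → δ i * x i r) j ⟩
    δ j * x j r + sum (λ i → δ (punchIn j i) * x (punchIn j i) r)
      ≡⟨ cong₂ _+_ (cong (δ j *_) (xⱼ≡0 r)) (sum-zero (δ∘punchIn≡0 r)) ⟩
    δ j * 0ℤ + 0ℤ                                       ≡⟨ cong (_+ 0ℤ) (*-zeroʳ (δ j)) ⟩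
    0ℤ                                                  ∎

Omits : ∀ {n k} → Fin n → Vec (Fin n) k → Set
Omits m I = ∀ a → lookup I a ≢ m

IsInsertion : ∀ {n k} → Fin (suc n) → Vec (Fin n) k → Vec (Fin (suc n)) (suc k) → Set
IsInsertion {k = k} m J I =
  Σ[ a ∈ Fin (suc k) ] lookup I a ≡ m × (∀ x → lookup I (punchIn a x) ≡ punchIn m (lookup J x))

omits-zero : ∀ {n k} (v : Vec (Fin n) k) → Omits zero (Vec.map suc v)
omits-zero v a vₐ≡0 = 0≢1+n (trans (sym vₐ≡0) (lookup-map a suc v))

omits-map-suc : ∀ {n k} {m : Fin n} (v : Vec (Fin n) k) → Omits m v → Omits (suc m) (Vec.map suc v)
omits-map-suc v m∉v a vₐ≡m = m∉v a (suc-injective (trans (sym (lookup-map a suc v)) vₐ≡m))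

omits-cons-zero : ∀ {n k} {m : Fin n} (v : Vec (Fin n) k) → Omits m v → Omits (suc m) (zero ∷ Vec.map suc v)
omits-cons-zero v m∉v zero    ()
omits-cons-zero v m∉v (suc a) = omits-map-suc v m∉v a

insertion-zero : ∀ {n k} (v : Vec (Fin n) k) → IsInsertion zero v (zero ∷ Vec.map suc v)
insertion-zero v = zero , refl , λ x → lookup-map x suc v

insertion-map-suc : ∀ {n k} {m : Fin (suc n)} (w : Vec (Fin n) k) v →
  IsInsertion m w v → IsInsertion (suc m) (Vec.map suc w) (Vec.map suc v)
insertion-map-suc {m = m} w v (a , vₐ≡m , v∘punchIn) =
  a , trans (lookup-map a suc v) (cong suc vₐ≡m) , λ x → begin
    lookup (Vec.map suc v) (punchIn a x)      ≡⟨ lookup-map (punchIn a x) suc v ⟩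
    suc (lookup v (punchIn a x))              ≡⟨ cong suc (v∘punchIn x) ⟩
    suc (punchIn m (lookup w x))              ≡⟨ cong (punchIn (suc m)) (lookup-map x suc w) ⟨
    punchIn (suc m) (lookup (Vec.map suc w) x) ∎

insertion-cons-zero : ∀ {n k} {m : Fin (suc n)} (w : Vec (Fin n) k) v →
  IsInsertion m w v → IsInsertion (suc m) (zero ∷ Vec.map suc w) (zero ∷ Vec.map suc v)
insertion-cons-zero w v m∈v with insertion-map-suc w v m∈v
... | a , vₐ≡m , v∘punchIn = suc a , vₐ≡m , λ { zero → refl ; (suc x) → v∘punchIn x }

sumℕ-choose-suc : ∀ L N (F : Vec (Fin (suc N)) (suc L) → ℕ) →
  sumℕ (map F (choose (suc L) (suc N)))
    ≡ sumℕ (map (λ v → F (zero ∷ Vec.map suc v)) (choose L N)) ℕ.+ sumℕ (map (F ∘ Vec.map suc) (choose (suc L) N))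
sumℕ-choose-suc L N F = begin
  sumℕ (map F (map f (choose L N) ++ map g (choose (suc L) N)))
    ≡⟨ cong sumℕ (map-++ F (map f (choose L N)) _) ⟩
  sumℕ (map F (map f (choose L N)) ++ map F (map g (choose (suc L) N)))
    ≡⟨ sumℕ-++ (map F (map f (choose L N))) _ ⟩
  sumℕ (map F (map f (choose L N))) ℕ.+ sumℕ (map F (map g (choose (suc L) N)))
    ≡⟨ cong₂ (λ xs ys → sumℕ xs ℕ.+ sumℕ ys) (map-∘ (choose L N)) (map-∘ (choose (suc L) N)) ⟨
  sumℕ (map (F ∘ f) (choose L N)) ℕ.+ sumℕ (map (F ∘ g) (choose (suc L) N))
    ∎
  where
  f : Vec (Fin N) L → Vec (Fin (suc N)) (suc L)
  f v = zero ∷ Vec.map suc v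
  g : Vec (Fin N) (suc L) → Vec (Fin (suc N)) (suc L)
  g = Vec.map suc

sumℕ-choose-insertion : ∀ {L N} (m : Fin (suc N))
  (F : Vec (Fin (suc N)) (suc L) → ℕ) (H : Vec (Fin N) L → ℕ) →
  (∀ I → Omits m I → F I ≡ 0) → (∀ J I → IsInsertion m J I → F I ≡ H J) →
  sumℕ (map F (choose (suc L) (suc N))) ≡ sumℕ (map H (choose L N))
sumℕ-choose-insertion {L} {N} zero F H omitted inserted = begin
  sumℕ (map F (choose (suc L) (suc N)))
    ≡⟨ sumℕ-choose-suc L N F ⟩
  sumℕ (map (λ v → F (zero ∷ Vec.map suc v)) (choose L N)) ℕ.+ sumℕ (map (F ∘ Vec.map suc) (choose (suc L) N))
    ≡⟨ cong₂ ℕ._+_ (cong sumℕ (map-cong (λ v → inserted v _ (insertion-zero v)) (choose L N)))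
                   (sumℕ-map-zero (choose (suc L) N) (λ v → omitted _ (omits-zero v))) ⟩
  sumℕ (map H (choose L N)) ℕ.+ 0
    ≡⟨ ℕ.+-identityʳ _ ⟩
  sumℕ (map H (choose L N))
    ∎
sumℕ-choose-insertion {zero} {suc N} (suc m) F H omitted inserted = begin
  sumℕ (map F (choose 1 (suc (suc N))))
    ≡⟨ sumℕ-choose-suc 0 (suc N) F ⟩
  (F (zero ∷ []) ℕ.+ 0) ℕ.+ sumℕ (map (F ∘ Vec.map suc) (choose 1 (suc N)))
    ≡⟨ cong₂ ℕ._+_ (cong (ℕ._+ 0) (omitted (zero ∷ []) λ { zero () }))
                   (sumℕ-choose-insertion m (F ∘ Vec.map suc) (H ∘ Vec.map suc)
                      (λ v → omitted _ ∘ omits-map-suc v) (λ w v → inserted _ _ ∘ insertion-map-suc w v)) ⟩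
  sumℕ (map H (choose 0 (suc N)))
    ∎
sumℕ-choose-insertion {suc L} {suc N} (suc m) F H omitted inserted = begin
  sumℕ (map F (choose (suc (suc L)) (suc (suc N))))
    ≡⟨ sumℕ-choose-suc (suc L) (suc N) F ⟩
  sumℕ (map (λ v → F (zero ∷ Vec.map suc v)) (choose (suc L) (suc N)))
    ℕ.+ sumℕ (map (F ∘ Vec.map suc) (choose (suc (suc L)) (suc N)))
    ≡⟨ cong₂ ℕ._+_
         (sumℕ-choose-insertion m _ _ (λ v → omitted _ ∘ omits-cons-zero v)
                                      (λ w v → inserted _ _ ∘ insertion-cons-zero w v))
         (sumℕ-choose-insertion m _ _ (λ v → omitted _ ∘ omits-map-suc v)
                                      (λ w v → inserted _ _ ∘ insertion-map-suc w v)) ⟩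
  sumℕ (map (λ w → H (zero ∷ Vec.map suc w)) (choose L N)) ℕ.+ sumℕ (map (H ∘ Vec.map suc) (choose (suc L) N))
    ≡⟨ sumℕ-choose-suc L N H ⟨
  sumℕ (map H (choose (suc L) (suc N)))
    ∎

rows : ∀ {M k} → Vec (Fin M) k → (Fin k → Pt M) → Matrix k
rows I x a b = x b (lookup I a)

module Contraction {N L : ℕ} (ξ : Fin (suc L) → Pt (suc N)) (p : Fin (suc L)) (m : Fin (suc N))
                   (ε : ℤ) (ε*ε≡1 : ε * ε ≡ 1ℤ) (ξₚ≡εeₘ : ∀ r → ξ p r ≡ ε * e m r) where

  η : Fin L → Pt N
  η j r = ξ (punchIn p j) (punchIn m r)

  -- A relation among the η j lifts to one among the ξ i: the coefficient of ξ p
  -- is chosen to cancel the m-th coordinate.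
  η-linIndep : LinIndep (suc N) (suc L) ξ → LinIndep N L η
  η-linIndep ξ-indep c Σcη≡0 j = begin
    c j               ≡⟨ insertAt-punchIn c p v j ⟨
    c′ (punchIn p j)  ≡⟨ ξ-indep c′ Σc′ξ≡0 (punchIn p j) ⟩
    0ℤ                ∎
    where
    Σcξ : Fin (suc N) → ℤ
    Σcξ r = sumℤ L (λ j → c j * ξ (punchIn p j) r)
    v = - (ε * Σcξ m)
    c′ = insertAt c p v
    cancel : ∀ {r} → PunchInView m r → v * (ε * e m r) + Σcξ r ≡ 0ℤ
    cancel at-hole = begin
      v * (ε * e m m) + Σcξ m          ≡⟨ cong (λ t → v * (ε * t) + Σcξ m) (e-diag m) ⟩
      - (ε * T) * (ε * 1ℤ) + T         ≡⟨ regroup ε T ⟩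
      - ((ε * ε) * T) + T              ≡⟨ cong (λ t → - (t * T) + T) ε*ε≡1 ⟩
      - (1ℤ * T) + T                   ≡⟨ cancel-1 T ⟩
      0ℤ                               ∎
      where
      T = Σcξ m
      regroup : ∀ ε T → - (ε * T) * (ε * 1ℤ) + T ≡ - ((ε * ε) * T) + T
      regroup = solve-∀
      cancel-1 : ∀ T → - (1ℤ * T) + T ≡ 0ℤ
      cancel-1 = solve-∀
    cancel (punched r) = begin
      v * (ε * e m (punchIn m r)) + Σcξ (punchIn m r)  ≡⟨ cong₂ (λ t u → v * (ε * t) + u) (e-hole m r) (Σcη≡0 r) ⟩
      v * (ε * 0ℤ) + 0ℤ                                ≡⟨ vanish v ε ⟩
      0ℤ                                               ∎
      where
      vanish : ∀ v ε → v * (ε * 0ℤ) + 0ℤ ≡ 0ℤ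
      vanish = solve-∀
    Σc′ξ≡0 : ∀ r → sumℤ (suc L) (λ i → c′ i * ξ i r) ≡ 0ℤ
    Σc′ξ≡0 r = begin
      sumℤ (suc L) (λ i → c′ i * ξ i r)
        ≡⟨ sumℤ-remove (λ i → c′ i * ξ i r) p ⟩
      c′ p * ξ p r + sum (λ j → c′ (punchIn p j) * ξ (punchIn p j) r)
        ≡⟨ cong₂ _+_ (cong₂ _*_ (insertAt-lookup c p v) (ξₚ≡εeₘ r))
                     (sum-cong-≗ (λ j → cong (_* ξ (punchIn p j) r) (insertAt-punchIn c p v j))) ⟩
      v * (ε * e m r) + sum (λ j → c j * ξ (punchIn p j) r)
        ≡⟨ cong (v * (ε * e m r) +_) (sumℤ≡sum L _) ⟨
      v * (ε * e m r) + Σcξ r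
        ≡⟨ cancel (punchIn-view m r) ⟩
      0ℤ
        ∎

  η∈E : LinIndep N L η → ∀ {j} → InE (suc N) (ξ (punchIn p j)) → InE N (η j)
  η∈E η-indep {j} ξⱼ∈E = InE-∘-punchIn m ξⱼ∈E (LinIndep⇒nonzero η-indep j)

  η∈E∪F : LinIndep N L η → ∀ {j} →
    InE (suc N) (ξ (punchIn p j)) ⊎ InF (suc N) (ξ (punchIn p j)) → InE N (η j) ⊎ InF N (η j)
  η∈E∪F η-indep (inj₁ ξⱼ∈E) = inj₁ (η∈E η-indep ξⱼ∈E)
  η∈E∪F η-indep (inj₂ ξⱼ∈F) = InF-∘-punchIn m ξⱼ∈F

  wedgeNorm-η : wedgeNorm (suc N) (suc L) ξ ≡ wedgeNorm N L η
  wedgeNorm-η = sumℕ-choose-insertion m (λ I → ℤ.∣ det (suc L) (rows I ξ) ∣) (λ J → ℤ.∣ det L (rows J η) ∣)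
    omitted inserted
    where
    omitted : ∀ I → Omits m I → ℤ.∣ det (suc L) (rows I ξ) ∣ ≡ 0
    omitted I m∉I = cong ℤ.∣_∣ (det-zeroColumn (suc L) (rows I ξ) p column≡0)
      where
      column≡0 : ∀ a → ξ p (lookup I a) ≡ 0ℤ
      column≡0 a = trans (ξₚ≡εeₘ _) (trans (cong (ε *_) (e-off (m∉I a ∘ sym))) (*-zeroʳ ε))
    inserted : ∀ J I → IsInsertion m J I → ℤ.∣ det (suc L) (rows I ξ) ∣ ≡ ℤ.∣ det L (rows J η) ∣
    inserted J I (a , Iₐ≡m , I∘punchIn) = begin
      ℤ.∣ det (suc L) (rows I ξ) ∣
        ≡⟨ cong ℤ.∣_∣ (det-expandColumn L (rows I ξ) a p column≡0) ⟩
      ℤ.∣ -1ℤ ^ (toℕ a ℕ.+ toℕ p) * (ξ p (lookup I a) * det L (minor a p (rows I ξ))) ∣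
        ≡⟨ ∣u*i∣≡∣i∣ (-1ℤ ^ (toℕ a ℕ.+ toℕ p)) _ (∣-1^n∣≡1 (toℕ a ℕ.+ toℕ p)) ⟩
      ℤ.∣ ξ p (lookup I a) * det L (minor a p (rows I ξ)) ∣
        ≡⟨ ∣u*i∣≡∣i∣ (ξ p (lookup I a)) _ ∣ξₚ[Iₐ]∣≡1 ⟩
      ℤ.∣ det L (minor a p (rows I ξ)) ∣
        ≡⟨ cong ℤ.∣_∣ (det-cong L (λ x y → cong (ξ (punchIn p y)) (I∘punchIn x))) ⟩
      ℤ.∣ det L (rows J η) ∣
        ∎
      where
      column≡0 : ∀ x → ξ p (lookup I (punchIn a x)) ≡ 0ℤ
      column≡0 x = begin
        ξ p (lookup I (punchIn a x))        ≡⟨ ξₚ≡εeₘ _ ⟩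
        ε * e m (lookup I (punchIn a x))    ≡⟨ cong (λ i → ε * e m i) (I∘punchIn x) ⟩
        ε * e m (punchIn m (lookup J x))    ≡⟨ cong (ε *_) (e-hole m (lookup J x)) ⟩
        ε * 0ℤ                              ≡⟨ *-zeroʳ ε ⟩
        0ℤ                                  ∎
      ∣ξₚ[Iₐ]∣≡1 : ℤ.∣ ξ p (lookup I a) ∣ ≡ 1
      ∣ξₚ[Iₐ]∣≡1 = begin
        ℤ.∣ ξ p (lookup I a) ∣      ≡⟨ cong ℤ.∣_∣ (ξₚ≡εeₘ _) ⟩
        ℤ.∣ ε * e m (lookup I a) ∣  ≡⟨ cong (λ i → ℤ.∣ ε * e m i ∣) Iₐ≡m ⟩
        ℤ.∣ ε * e m m ∣             ≡⟨ cong (λ t → ℤ.∣ ε * t ∣) (e-diag m) ⟩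
        ℤ.∣ ε * 1ℤ ∣                ≡⟨ cong ℤ.∣_∣ (*-identityʳ ε) ⟩
        ℤ.∣ ε ∣                     ≡⟨ i*i≡1⇒∣i∣≡1 ε ε*ε≡1 ⟩
        1                           ∎

member-removeAt : ∀ {n K} (S : Subset (suc n)) → ∣ S ∣ ≡ suc K →
  Σ[ p ∈ Fin (suc n) ] p ∈ S × ∣ removeAt S p ∣ ≡ K
member-removeAt (inside ∷ S) ∣S∣≡1+K = zero , here , ℕ.suc-injective ∣S∣≡1+K
member-removeAt {suc n} (outside ∷ S@(_ ∷ _)) ∣S∣≡1+K with member-removeAt S ∣S∣≡1+K
... | p , p∈S , ∣S′∣≡K = suc p , there p∈S , ∣S′∣≡K

∈-removeAt⁻ : ∀ {n} (S : Subset (suc n)) p {j} → j ∈ removeAt S p → punchIn p j ∈ S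
∈-removeAt⁻ (_ ∷ S)       zero              j∈S′        = there j∈S′
∈-removeAt⁻ (_ ∷ _ ∷ S)   (suc p) {zero}    here        = here
∈-removeAt⁻ (_ ∷ S@(_ ∷ _)) (suc p) {suc j} (there j∈S′) = there (∈-removeAt⁻ S p j∈S′)

WedgeNormAttained : ℕ → ℕ → ℕ → Set
WedgeNormAttained M L w =
  Σ (Fin L → Pt M) λ η → (∀ i → InE M (η i) ⊎ InF M (η i)) × LinIndep M L η × w ≡ wedgeNorm M L η

wedgeNorm-attained : ∀ K N L (ξ : Fin L → Pt N) →
  (∀ i → InE N (ξ i) ⊎ InF N (ξ i)) → LinIndep N L ξ →
  (S : Subset L) → ∣ S ∣ ≡ K → (∀ {i} → i ∈ S → InE N (ξ i)) →
  WedgeNormAttained (N ∸ K) (L ∸ K) (wedgeNorm N L ξ)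
wedgeNorm-attained zero N L ξ ξ∈E∪F ξ-indep _ _ _ = ξ , ξ∈E∪F , ξ-indep , refl
wedgeNorm-attained (suc K) N zero _ _ _ [] () _
wedgeNorm-attained (suc K) N (suc L) ξ ξ∈E∪F ξ-indep S ∣S∣≡1+K S⊆E
  with member-removeAt S ∣S∣≡1+K
... | p , p∈S , ∣S′∣≡K with InE⇒unit*e (S⊆E p∈S)
wedgeNorm-attained (suc K) (suc N) (suc L) ξ ξ∈E∪F ξ-indep S _ S⊆E
    | p , p∈S , ∣S′∣≡K | m , ε , ε*ε≡1 , ξₚ≡εeₘ =
  subst (WedgeNormAttained (N ∸ K) (L ∸ K)) (sym wedgeNorm-η)
    (wedgeNorm-attained K N L η (λ j → η∈E∪F η-indep (ξ∈E∪F (punchIn p j))) η-indep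
       (removeAt S p) ∣S′∣≡K (η∈E η-indep ∘ S⊆E ∘ ∈-removeAt⁻ S p))
  where
  open Contraction ξ p m ε ε*ε≡1 ξₚ≡εeₘ
  η-indep = η-linIndep ξ-indep

lemma2p5 : (N L K : ℕ) → (ξ : Fin L → Pt N)
    → (∀ i → InE N (ξ i) ⊎ InF N (ξ i))
    → LinIndep N L ξ
    → (Σ (Subset L) λ S → ∣ S ∣ ≡ K × (∀ i → (i ∈ S) ⇔ InE N (ξ i)))
    → 1 ≤ K → K < L
    → Σ (Fin (L ∸ K) → Pt (N ∸ K)) λ η →
        (∀ i → InE (N ∸ K) (η i) ⊎ InF (N ∸ K) (η i))
        × LinIndep (N ∸ K) (L ∸ K) η
        × wedgeNorm N L ξ ≡ wedgeNorm (N ∸ K) (L ∸ K) η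
lemma2p5 N L K ξ ξ∈E∪F ξ-indep (S , ∣S∣≡K , S⇔E) _ _ =
  wedgeNorm-attained K N L ξ ξ∈E∪F ξ-indep S ∣S∣≡K (Equivalence.to (S⇔E _))
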